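{- Let $n\ge 1$. (a) If $F\colon\mathbb{F}_2^n\to\mathbb{F}_2^n$ satisfies $F\circ S=S^k\circ F$ for some $1\leq k\leq n$, then $F$ is cyclic. (b) For $1\leq j,\ell\leq n$ let $X_{j,\ell}=\{F\colon\mathbb{F}_2^n\to\mathbb{F}_2^n \mid F\circ S^j=S^\ell\circ F\}$. Then $X_{j,\ell}$ is contained in the set of all cyclic functions if and only if $\gcd(j,n)=1$. (c) If $\gcd(j,n)=1$, then there is some $1\leq k\leq n$ such that $X_{j,\ell}=X_{1,k}$.
   Context: $S$ is the right cyclic shift on $\mathbb{F}_2^n$, $S(x_1,\dotsc,x_n)=(x_n,x_1,\dotsc,x_{n-1})$. The cycle of $x$ is $c(x)=\{S^j(x):j\in\mathbb{Z}\}$. A map $F\colon\mathbb{F}_2^n\to\mathbb{F}_2^n$ is cyclic if for every cycle $X$, the image $F(X)$ is contained in a cycle. -}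

module Defs where

open import Data.Bool using (Bool)
open import Data.Nat using (ℕ; zero; suc)
open import Data.Integer using (ℤ; +_; -[1+_])
open import Data.Vec using (Vec; []; _∷_; last; init; _∷ʳ_)
open import Data.Product using (∃)
open import Relation.Binary.PropositionalEquality using (_≡_)
open import Function using (_∘_)

-- 𝔽₂ⁿ, with 𝔽₂ represented by Bool (only the underlying set matters here)
F2^ : ℕ → Set
F2^ n = Vec Bool n

S : ∀ {n} → F2^ n → F2^ n
S []       = []
S (x ∷ xs) = last (x ∷ xs) ∷ init (x ∷ xs)

S⁻¹ : ∀ {n} → F2^ n → F2^ n
S⁻¹ []       = []
S⁻¹ (x ∷ xs) = xs ∷ʳ x

iter : ∀ {A : Set} → (A → A) → ℕ → A → A
iter f zero    = λ a → a
iter f (suc m) = f ∘ iter f m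

S^ : ∀ {n} → ℕ → F2^ n → F2^ n
S^ j = iter S j

Sᶻ : ∀ {n} → ℤ → F2^ n → F2^ n
Sᶻ (+ m)      = iter S m
Sᶻ -[1+ m ]   = iter S⁻¹ (suc m)

_∈cycleOf_ : ∀ {n} → F2^ n → F2^ n → Set
z ∈cycleOf x = ∃ λ (j : ℤ) → z ≡ Sᶻ j x

Cyclic : ∀ {n} → (F2^ n → F2^ n) → Set
Cyclic {n} F = ∀ (x : F2^ n) → ∃ λ (y : F2^ n) →
  ∀ (z : F2^ n) → z ∈cycleOf x → F z ∈cycleOf y

InX : ∀ {n} → ℕ → ℕ → (F2^ n → F2^ n) → Set
InX {n} j ℓ F = ∀ (x : F2^ n) → F (S^ j x) ≡ S^ ℓ (F x)

-- Everything reduces to exponent arithmetic modulo n, because S has order n.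
-- (a) F ∘ S = S^k ∘ F iterates to F ∘ S^m = S^(mk) ∘ F, so F maps c(x) into c(F x).
-- (b, c) If j is invertible modulo n, with i j ≡ 1, then F ∘ S^j = S^ℓ ∘ F iterates
-- i times to F ∘ S = S^(iℓ) ∘ F, which is part (a). Conversely, the indicator of the
-- S^j-orbit of e₁ = (1,0,…,0), valued in the two constant vectors, lies in X_{j,ℓ}
-- since constant vectors are fixed by S; as each constant vector is a cycle on its
-- own, this indicator is cyclic only if S e₁ lies in the S^j-orbit of e₁, and since
-- e₁ has period exactly n this forces j to be invertible modulo n.
module Submission where

open import Defs
open import Data.Nat using (ℕ; _≤_)
open import Data.Nat.GCD using (gcd)
open import Data.Product using (_×_; ∃)
open import Function.Bundles using (_⇔_)
open import Relation.Binary.PropositionalEquality using (_≡_)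

open import Data.Bool using (Bool; true; false) renaming (_≟_ to _≟ᵇ_)
open import Data.Fin using (Fin; toℕ; fromℕ<)
open import Data.Fin.Properties using (any?; toℕ-fromℕ<)
open import Data.Integer using (+_; -[1+_])
open import Data.List as List using (List; _++_)
open import Data.List.Properties using (++-assoc; ++-identityʳ; length-replicate)
open import Data.Nat using (zero; suc; _+_; _*_; _∸_; _<_; _%_; _/_; s≤s; z≤n)
open import Data.Nat.Coprimality using (coprime-Bézout; gcd≡1⇒coprime)
open import Data.Nat.DivMod
  using (m≡m%n+[m/n]*n; m%n<n; m%n%n≡m%n; n%n≡0; %-distribˡ-*; [m+kn]%n≡m%n; m*n%n≡0)
open import Data.Nat.Divisibility
  using (_∣_; ∣1⇒≡1; ∣m+n∣m⇒∣n; ∣-trans; ∣m⇒∣m*n; n∣m*n; m%n≡0⇒n∣m)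
open import Data.Nat.GCD using (gcd[m,n]∣m; gcd[m,n]∣n; module Bézout)
open import Data.Nat.Properties using (+-comm; +-suc; *-comm; *-suc; *-identityʳ; *-identityˡ; ≤-refl; <⇒≤; ≤-pred; m+[n∸m]≡n)
open import Data.Nat.Solver using (module +-*-Solver)
open import Data.Product using (_,_)
open import Data.Vec using (_∷_; []; _∷ʳ_; replicate; toList; head)
open import Data.Vec.Properties
  using (≡-dec; init-∷ʳ; last-∷ʳ; toList-∷ʳ; toList-injective; toList-replicate; length-toList)
open import Data.Vec.Relation.Binary.Equality.Cast using (cast-is-id)
open import Function.Bundles using (mk⇔)
open import Relation.Binary.PropositionalEquality
  using (_≢_; refl; sym; trans; cong; cong₂; subst; _≗_; module ≡-Reasoning)
open import Relation.Nullary using (Dec; yes; does; contradiction)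
open import Relation.Nullary.Decidable using (map′; dec-true; does-⇔)
open import Relation.Unary using (Pred; Decidable)
open import Level using (0ℓ)

open ≡-Reasoning
open +-*-Solver using (solve; _:+_; _:*_; _:=_; con)

private
  variable
    A : Set
    n p : ℕ

iter-+ : ∀ (f : A → A) a b x → iter f (a + b) x ≡ iter f a (iter f b x)
iter-+ f zero    b x = refl
iter-+ f (suc a) b x = cong f (iter-+ f a b x)

iter-* : ∀ (f : A → A) a b x → iter f (a * b) x ≡ iter (iter f b) a x
iter-* f zero    b x = refl
iter-* f (suc a) b x = trans (iter-+ f b (a * b) x) (cong (iter f b) (iter-* f a b x))

iter-cong : ∀ {f g : A → A} → f ≗ g → ∀ a → iter f a ≗ iter g a
iter-cong f≗g zero    x = refl
iter-cong {f = f} {g} f≗g (suc a) x = trans (f≗g (iter f a x)) (cong g (iter-cong f≗g a x))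

iter-fixedPoint : ∀ (f : A → A) {x} → f x ≡ x → ∀ a → iter f a x ≡ x
iter-fixedPoint f fx≡x zero    = refl
iter-fixedPoint f fx≡x (suc a) = trans (cong f (iter-fixedPoint f fx≡x a)) fx≡x

iter-cancelˡ : ∀ {f g : A → A} → (∀ x → g (f x) ≡ x) → ∀ a x → iter g a (iter f a x) ≡ x
iter-cancelˡ {f = f} {g} gf≗id zero    x = refl
iter-cancelˡ {f = f} {g} gf≗id (suc a) x = begin
  iter g (suc a) (f (iter f a x)) ≡⟨ cong (λ m → iter g m (f (iter f a x))) (+-comm 1 a) ⟩
  iter g (a + 1) (f (iter f a x)) ≡⟨ iter-+ g a 1 (f (iter f a x)) ⟩
  iter g a (g (f (iter f a x)))   ≡⟨ cong (iter g a) (gf≗id (iter f a x)) ⟩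
  iter g a (iter f a x)           ≡⟨ iter-cancelˡ gf≗id a x ⟩
  x                               ∎

%-*-cong : ∀ a b c d → a % suc p ≡ b % suc p → c % suc p ≡ d % suc p →
           (a * c) % suc p ≡ (b * d) % suc p
%-*-cong {p} a b c d a≡b c≡d = begin
  (a * c) % suc p                 ≡⟨ %-distribˡ-* a c (suc p) ⟩
  (a % suc p * (c % suc p)) % suc p ≡⟨ cong₂ (λ x y → (x * y) % suc p) a≡b c≡d ⟩
  (b % suc p * (d % suc p)) % suc p ≡⟨ %-distribˡ-* b d (suc p) ⟨
  (b * d) % suc p                 ∎

%-representative : ∀ a → ∃ λ k → 1 ≤ k × k ≤ suc p × k % suc p ≡ a % suc p
%-representative {p} a with a % suc p in eq
... | zero  = suc p , s≤s z≤n , ≤-refl , n%n≡0 (suc p)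
... | suc r = suc r , s≤s z≤n , <⇒≤ (subst (_< suc p) eq (m%n<n a (suc p))) ,
              trans (cong (_% suc p) (sym eq)) (trans (m%n%n≡m%n a (suc p)) eq)

gcd≡1⇒invertible : ∀ j → gcd j (suc p) ≡ 1 → ∃ λ i → (i * j) % suc p ≡ 1 % suc p
gcd≡1⇒invertible {p} j g with coprime-Bézout (gcd≡1⇒coprime g)
... | Bézout.+- x y eq = x , (begin
  (x * j) % suc p         ≡⟨ cong (_% suc p) eq ⟨
  (1 + y * suc p) % suc p ≡⟨ [m+kn]%n≡m%n 1 y (suc p) ⟩
  1 % suc p               ∎)
-- Here x j ≡ -1 modulo n = 1 + p, so (x p) j ≡ -p ≡ 1.
... | Bézout.-+ x y eq = x * p , (begin
  (x * p * j) % suc p               ≡⟨ [m+kn]%n≡m%n (x * p * j) 1 (suc p) ⟨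
  (x * p * j + 1 * suc p) % suc p   ≡⟨ cong (_% suc p) (rearrange x p j) ⟩
  ((1 + x * j) * p + 1) % suc p     ≡⟨ cong (λ m → (m * p + 1) % suc p) eq ⟩
  (y * suc p * p + 1) % suc p       ≡⟨ cong (_% suc p) (+-comm (y * suc p * p) 1) ⟩
  (1 + y * suc p * p) % suc p       ≡⟨ cong (λ m → (1 + m) % suc p) (rotate y (suc p) p) ⟩
  (1 + y * p * suc p) % suc p       ≡⟨ [m+kn]%n≡m%n 1 (y * p) (suc p) ⟩
  1 % suc p                         ∎)
  where
  rearrange : ∀ x p j → x * p * j + 1 * suc p ≡ (1 + x * j) * p + 1
  rearrange = solve 3 (λ x p j → x :* p :* j :+ con 1 :* (con 1 :+ p) := (con 1 :+ x :* j) :* p :+ con 1) refl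
  rotate : ∀ y n p → y * n * p ≡ y * p * n
  rotate = solve 3 (λ y n p → y :* n :* p := y :* p :* n) refl

j∣x∧n∣x+1⇒gcd[j,n]≡1 : ∀ {j n x} → j ∣ x → n ∣ x + 1 → gcd j n ≡ 1
j∣x∧n∣x+1⇒gcd[j,n]≡1 {j} {n} {x} j∣x n∣x+1 =
  ∣1⇒≡1 (∣m+n∣m⇒∣n (∣-trans (gcd[m,n]∣n j n) n∣x+1) (∣-trans (gcd[m,n]∣m j n) j∣x))

rotateˡ : List A → List A
rotateˡ List.[]       = List.[]
rotateˡ (x List.∷ xs) = xs ++ List.[ x ]

rotateˡ-++ : ∀ (xs ys : List A) → iter rotateˡ (List.length xs) (xs ++ ys) ≡ ys ++ xs
rotateˡ-++ List.[]       ys = sym (++-identityʳ ys)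
rotateˡ-++ (x List.∷ xs) ys = begin
  iter rotateˡ (suc (List.length xs)) (x List.∷ xs ++ ys)     ≡⟨ cong (λ m → iter rotateˡ m (x List.∷ xs ++ ys)) (+-comm 1 (List.length xs)) ⟩
  iter rotateˡ (List.length xs + 1) (x List.∷ xs ++ ys)       ≡⟨ iter-+ rotateˡ (List.length xs) 1 _ ⟩
  iter rotateˡ (List.length xs) ((xs ++ ys) ++ List.[ x ])    ≡⟨ cong (iter rotateˡ (List.length xs)) (++-assoc xs ys List.[ x ]) ⟩
  iter rotateˡ (List.length xs) (xs ++ ys ++ List.[ x ])      ≡⟨ rotateˡ-++ xs _ ⟩
  (ys ++ List.[ x ]) ++ xs                                    ≡⟨ ++-assoc ys _ xs ⟩
  ys ++ x List.∷ xs                                           ∎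

replicate-+ : ∀ a b (x : A) → List.replicate (a + b) x ≡ List.replicate a x ++ List.replicate b x
replicate-+ zero    b x = refl
replicate-+ (suc a) b x = cong (x List.∷_) (replicate-+ a b x)

toList-iter-S⁻¹ : ∀ a (v : F2^ n) → toList (iter S⁻¹ a v) ≡ iter rotateˡ a (toList v)
toList-iter-S⁻¹ zero    v = refl
toList-iter-S⁻¹ (suc a) v with iter S⁻¹ a v | toList-iter-S⁻¹ a v
... | []    | eq = cong rotateˡ eq
... | x ∷ w | eq = trans (toList-∷ʳ x w) (cong rotateˡ eq)

S⁻¹-order : ∀ (v : F2^ n) → iter S⁻¹ n v ≡ v
S⁻¹-order {n} v = trans (sym (cast-is-id refl _)) (toList-injective refl _ _ (begin
  toList (iter S⁻¹ n v)                           ≡⟨ toList-iter-S⁻¹ n v ⟩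
  iter rotateˡ n (toList v)                       ≡⟨ cong₂ (iter rotateˡ) (sym (length-toList v)) (sym (++-identityʳ _)) ⟩
  iter rotateˡ (List.length (toList v)) (toList v ++ List.[]) ≡⟨ rotateˡ-++ (toList v) List.[] ⟩
  toList v                                        ∎))

S-S⁻¹ : ∀ (v : F2^ n) → S (S⁻¹ v) ≡ v
S-S⁻¹ []           = refl
S-S⁻¹ (x ∷ [])     = refl
S-S⁻¹ (x ∷ y ∷ xs) = cong₂ _∷_ (last-∷ʳ x (y ∷ xs)) (init-∷ʳ x (y ∷ xs))

S-order : ∀ (v : F2^ n) → S^ n v ≡ v
S-order {n} v = trans (cong (S^ n) (sym (S⁻¹-order v))) (iter-cancelˡ S-S⁻¹ n v)

S-replicate : ∀ n (b : Bool) → S (replicate n b) ≡ replicate n b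
S-replicate zero    b = refl
S-replicate (suc n) b = trans (cong S (sym (replicate-∷ʳ n))) (S-S⁻¹ (replicate (suc n) b))
  where
  replicate-∷ʳ : ∀ n → replicate n b ∷ʳ b ≡ replicate (suc n) b
  replicate-∷ʳ zero    = refl
  replicate-∷ʳ (suc n) = cong (b ∷_) (replicate-∷ʳ n)

S^-replicate : ∀ a (b : Bool) → S^ a (replicate n b) ≡ replicate n b
S^-replicate {n} a b = iter-fixedPoint S (S-replicate n b) a

S^-mod : ∀ a (v : F2^ (suc p)) → S^ a v ≡ S^ (a % suc p) v
S^-mod {p} a v = begin
  S^ a v                                      ≡⟨ cong (λ m → S^ m v) (m≡m%n+[m/n]*n a (suc p)) ⟩
  S^ (a % suc p + a / suc p * suc p) v        ≡⟨ iter-+ S (a % suc p) (a / suc p * suc p) v ⟩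
  S^ (a % suc p) (S^ (a / suc p * suc p) v)   ≡⟨ cong (S^ (a % suc p)) (iter-* S (a / suc p) (suc p) v) ⟩
  S^ (a % suc p) (iter (S^ (suc p)) (a / suc p) v) ≡⟨ cong (S^ (a % suc p)) (iter-fixedPoint (S^ (suc p)) (S-order v) (a / suc p)) ⟩
  S^ (a % suc p) v                            ∎

S^-cong-% : ∀ a b → a % suc p ≡ b % suc p → ∀ (v : F2^ (suc p)) → S^ a v ≡ S^ b v
S^-cong-% a b a≡b v = trans (S^-mod a v) (trans (cong (λ m → S^ m v) a≡b) (sym (S^-mod b v)))

S^-inverseˡ : ∀ a (v : F2^ (suc p)) → S^ (a * p) (S^ a v) ≡ v
S^-inverseˡ {p} a v = begin
  S^ (a * p) (S^ a v) ≡⟨ iter-+ S (a * p) a v ⟨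
  S^ (a * p + a) v    ≡⟨ S^-cong-% (a * p + a) 0 (trans (cong (_% suc p) a*p+a≡a*[1+p]) (m*n%n≡0 a (suc p))) v ⟩
  v                   ∎
  where
  a*p+a≡a*[1+p] : a * p + a ≡ a * suc p
  a*p+a≡a*[1+p] = trans (+-comm (a * p) a) (sym (*-suc a p))

S⁻¹≗S^ : ∀ (v : F2^ (suc p)) → S⁻¹ v ≡ S^ p v
S⁻¹≗S^ {p} v = begin
  S⁻¹ v              ≡⟨ S-order (S⁻¹ v) ⟨
  S^ (suc p) (S⁻¹ v) ≡⟨ cong (λ m → S^ m (S⁻¹ v)) (+-comm 1 p) ⟩
  S^ (p + 1) (S⁻¹ v) ≡⟨ iter-+ S p 1 (S⁻¹ v) ⟩
  S^ p (S (S⁻¹ v))   ≡⟨ cong (S^ p) (S-S⁻¹ v) ⟩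
  S^ p v             ∎

iter-S⁻¹ : ∀ a (v : F2^ (suc p)) → iter S⁻¹ a v ≡ S^ (a * p) v
iter-S⁻¹ {p} a v = trans (iter-cong S⁻¹≗S^ a v) (sym (iter-* S a p v))

∈cycleOf⇒S^ : ∀ {z x : F2^ (suc p)} → z ∈cycleOf x → ∃ λ a → z ≡ S^ a x
∈cycleOf⇒S^ (+ a      , z≡) = a , z≡
∈cycleOf⇒S^ {p} {x = x} (-[1+ a ] , z≡) = suc a * p , trans z≡ (iter-S⁻¹ (suc a) x)

S-fixedPoint-cycle : ∀ {v y : F2^ (suc p)} → S v ≡ v → v ∈cycleOf y → y ≡ v
S-fixedPoint-cycle {p} {v} {y} Sv≡v v∈cy with ∈cycleOf⇒S^ v∈cy
... | a , v≡ = begin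
  y                   ≡⟨ S^-inverseˡ a y ⟨
  S^ (a * p) (S^ a y) ≡⟨ cong (S^ (a * p)) v≡ ⟨
  S^ (a * p) v        ≡⟨ iter-fixedPoint S Sv≡v (a * p) ⟩
  v                   ∎

e₁ : F2^ (suc p)
e₁ {p} = true ∷ replicate p false

iter-S⁻¹-e₁≢e₁ : ∀ {r} → r < p → iter S⁻¹ (suc r) (e₁ {p}) ≢ e₁
iter-S⁻¹-e₁≢e₁ {p} {r} r<p S⁻¹^[1+r]e₁≡e₁ = heads-differ (begin
  ys ++ xs                               ≡⟨ rotateˡ-++ xs ys ⟨
  iter rotateˡ (List.length xs) (xs ++ ys) ≡⟨ cong₂ (iter rotateˡ) (cong suc (length-replicate r)) (sym e₁-split) ⟩
  iter rotateˡ (suc r) (toList e₁)       ≡⟨ toList-iter-S⁻¹ (suc r) e₁ ⟨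
  toList (iter S⁻¹ (suc r) e₁)           ≡⟨ cong toList S⁻¹^[1+r]e₁≡e₁ ⟩
  toList e₁                              ≡⟨ e₁-split ⟩
  xs ++ ys                               ∎)
  where
  t : ℕ
  t = p ∸ suc r
  xs ys : List Bool
  xs = true List.∷ List.replicate r false
  ys = List.replicate (suc t) false
  e₁-split : toList (e₁ {p}) ≡ xs ++ ys
  e₁-split = cong (true List.∷_) (begin
    toList (replicate p false)  ≡⟨ toList-replicate p false ⟩
    List.replicate p false      ≡⟨ cong (λ m → List.replicate m false) (trans (+-suc r t) (m+[n∸m]≡n r<p)) ⟨
    List.replicate (r + suc t) false ≡⟨ replicate-+ r (suc t) false ⟩
    List.replicate r false ++ ys ∎)
  heads-differ : ys ++ xs ≢ xs ++ ys
  heads-differ ()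

S^-period-e₁ : ∀ c → S^ c (e₁ {p}) ≡ e₁ → suc p ∣ c
S^-period-e₁ {p} c S^ce₁≡e₁ with c % suc p in eq
... | zero  = m%n≡0⇒n∣m c (suc p) eq
... | suc r = contradiction (begin
  iter S⁻¹ (suc r) e₁    ≡⟨ iter-S⁻¹ (suc r) e₁ ⟩
  S^ (suc r * p) e₁      ≡⟨ cong (λ m → S^ m e₁) (*-comm (suc r) p) ⟩
  S^ (p * suc r) e₁      ≡⟨ iter-* S p (suc r) e₁ ⟩
  iter (S^ (suc r)) p e₁ ≡⟨ iter-fixedPoint (S^ (suc r)) S^[1+r]e₁≡e₁ p ⟩
  e₁                     ∎) (iter-S⁻¹-e₁≢e₁ r<p)
  where
  r<p : r < p
  r<p = ≤-pred (subst (_< suc p) eq (m%n<n c (suc p)))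
  S^[1+r]e₁≡e₁ : S^ (suc r) e₁ ≡ e₁
  S^[1+r]e₁≡e₁ = trans (cong (λ m → S^ m e₁) (sym eq)) (trans (sym (S^-mod c e₁)) S^ce₁≡e₁)

InOrbit : ℕ → F2^ n → Pred (F2^ n) 0ℓ
InOrbit j x z = ∃ λ m → z ≡ S^ (m * j) x

inOrbit? : ∀ j (x : F2^ (suc p)) → Decidable (InOrbit j x)
inOrbit? {p} j x z =
  map′ (λ (m , z≡) → toℕ m , z≡) bounded (any? λ m → ≡-dec _≟ᵇ_ z (S^ (toℕ m * j) x))
  where
  bounded : InOrbit j x z → ∃ λ (m : Fin (suc p)) → z ≡ S^ (toℕ m * j) x
  bounded (m , z≡) = fromℕ< (m%n<n m (suc p)) , (begin
    z                                            ≡⟨ z≡ ⟩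
    S^ (m * j) x                                 ≡⟨ S^-cong-% (m * j) (m % suc p * j) (%-*-cong m (m % suc p) j j (sym (m%n%n≡m%n m (suc p))) refl) x ⟩
    S^ (m % suc p * j) x                         ≡⟨ cong (λ k → S^ (k * j) x) (toℕ-fromℕ< (m%n<n m (suc p))) ⟨
    S^ (toℕ (fromℕ< (m%n<n m (suc p))) * j) x    ∎)

InOrbit-S^ : ∀ {j} {x z : F2^ n} → InOrbit j x z → InOrbit j x (S^ j z)
InOrbit-S^ {j = j} {x} (m , z≡) = suc m , trans (cong (S^ j) z≡) (sym (iter-+ S j (m * j) x))

InOrbit-S^⁻¹ : ∀ {j} {x z : F2^ (suc p)} → InOrbit j x (S^ j z) → InOrbit j x z
InOrbit-S^⁻¹ {p} {j} {x} {z} (m , S^jz≡) = p + m , (begin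
  z                          ≡⟨ S^-inverseˡ j z ⟨
  S^ (j * p) (S^ j z)        ≡⟨ cong (S^ (j * p)) S^jz≡ ⟩
  S^ (j * p) (S^ (m * j) x)  ≡⟨ iter-+ S (j * p) (m * j) x ⟨
  S^ (j * p + m * j) x       ≡⟨ cong (λ k → S^ k x) (regroup j p m) ⟩
  S^ ((p + m) * j) x         ∎)
  where
  regroup : ∀ j p m → j * p + m * j ≡ (p + m) * j
  regroup = solve 3 (λ j p m → j :* p :+ m :* j := (p :+ m) :* j) refl

indicator : ∀ {P : Pred (F2^ n) 0ℓ} → Decidable P → F2^ n → F2^ n
indicator {n} P? z = replicate n (does (P? z))

indicator-InX : ∀ {P : Pred (F2^ n) 0ℓ} (P? : Decidable P) j ℓ →
                (∀ z → P z ⇔ P (S^ j z)) → InX j ℓ (indicator P?)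
indicator-InX P? j ℓ P-invariant z = begin
  replicate _ (does (P? (S^ j z)))          ≡⟨ cong (replicate _) (does-⇔ (P-invariant z) (P? z) (P? (S^ j z))) ⟨
  replicate _ (does (P? z))                 ≡⟨ S^-replicate ℓ _ ⟨
  S^ ℓ (replicate _ (does (P? z)))          ∎

does≡true⇒ : (a? : Dec A) → does a? ≡ true → A
does≡true⇒ (yes a) _ = a

indicator-Cyclic⇒S-closed : ∀ {P : Pred (F2^ (suc p)) 0ℓ} (P? : Decidable P) →
                             Cyclic (indicator P?) → ∀ x → P x → P (S x)
indicator-Cyclic⇒S-closed P? cyclic x Px =
  does≡true⇒ (P? (S x)) (trans (sym (cong head same-cycle)) (dec-true (P? x) Px))
  where
  same-cycle : indicator P? x ≡ indicator P? (S x)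
  same-cycle with cyclic x
  ... | y , F[cx]⊆cy = trans (sym (S-fixedPoint-cycle (S-replicate _ _) (F[cx]⊆cy x (+ 0 , refl))))
                             (S-fixedPoint-cycle (S-replicate _ _) (F[cx]⊆cy (S x) (+ 1 , refl)))

InX-scale : ∀ a b {F : F2^ n → F2^ n} → InX a b F → ∀ m → InX (m * a) (m * b) F
InX-scale a b     h zero    x = refl
InX-scale a b {F} h (suc m) x = begin
  F (S^ (a + m * a) x)    ≡⟨ cong F (iter-+ S a (m * a) x) ⟩
  F (S^ a (S^ (m * a) x)) ≡⟨ h (S^ (m * a) x) ⟩
  S^ b (F (S^ (m * a) x)) ≡⟨ cong (S^ b) (InX-scale a b h m x) ⟩
  S^ b (S^ (m * b) (F x)) ≡⟨ iter-+ S b (m * b) (F x) ⟨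
  S^ (b + m * b) (F x)    ∎

InX-cong-% : ∀ a a′ b b′ {F : F2^ (suc p) → F2^ (suc p)} →
             a % suc p ≡ a′ % suc p → b % suc p ≡ b′ % suc p → InX a b F → InX a′ b′ F
InX-cong-% a a′ b b′ {F} a≡a′ b≡b′ h x =
  trans (cong F (S^-cong-% a′ a (sym a≡a′) x)) (trans (h x) (S^-cong-% b b′ b≡b′ (F x)))

InX-1⇒Cyclic : ∀ k {F : F2^ (suc p) → F2^ (suc p)} → InX 1 k F → Cyclic F
InX-1⇒Cyclic k {F} h x = F x , λ z z∈cx → let a , z≡ = ∈cycleOf⇒S^ z∈cx in + (a * k) , (begin
  F z              ≡⟨ cong F z≡ ⟩
  F (S^ a x)       ≡⟨ cong (λ m → F (S^ m x)) (*-identityʳ a) ⟨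
  F (S^ (a * 1) x) ≡⟨ InX-scale 1 k h a x ⟩
  S^ (a * k) (F x) ∎)

InX⇒InX-1 : ∀ i j ℓ k {F : F2^ (suc p) → F2^ (suc p)} →
            (i * j) % suc p ≡ 1 % suc p → k % suc p ≡ (i * ℓ) % suc p → InX j ℓ F → InX 1 k F
InX⇒InX-1 i j ℓ k ij≡1 k≡iℓ h = InX-cong-% (i * j) 1 (i * ℓ) k ij≡1 (sym k≡iℓ) (InX-scale j ℓ h i)

InX-1⇒InX : ∀ i j ℓ k {F : F2^ (suc p) → F2^ (suc p)} →
            (i * j) % suc p ≡ 1 % suc p → k % suc p ≡ (i * ℓ) % suc p → InX 1 k F → InX j ℓ F
InX-1⇒InX {p} i j ℓ k ij≡1 k≡iℓ h =
  InX-cong-% (j * 1) j (j * k) ℓ (cong (_% suc p) (*-identityʳ j)) jk≡ℓ (InX-scale 1 k h j)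
  where
  jk≡ℓ : (j * k) % suc p ≡ ℓ % suc p
  jk≡ℓ = begin
    (j * k) % suc p       ≡⟨ %-*-cong j j k (i * ℓ) refl k≡iℓ ⟩
    (j * (i * ℓ)) % suc p ≡⟨ cong (_% suc p) (solve 3 (λ i j ℓ → j :* (i :* ℓ) := i :* j :* ℓ) refl i j ℓ) ⟩
    (i * j * ℓ) % suc p   ≡⟨ %-*-cong (i * j) 1 ℓ ℓ ij≡1 refl ⟩
    (1 * ℓ) % suc p       ≡⟨ cong (_% suc p) (*-identityˡ ℓ) ⟩
    ℓ % suc p             ∎

S[e₁]∈orbit⇒gcd≡1 : ∀ {j} → InOrbit j (e₁ {p}) (S e₁) → gcd j (suc p) ≡ 1
S[e₁]∈orbit⇒gcd≡1 {p} {j} (m , Se₁≡) = j∣x∧n∣x+1⇒gcd[j,n]≡1 (∣m⇒∣m*n p (n∣m*n m)) (S^-period-e₁ _ (begin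
  S^ (m * j * p + 1) e₁        ≡⟨ iter-+ S (m * j * p) 1 e₁ ⟩
  S^ (m * j * p) (S e₁)        ≡⟨ cong (S^ (m * j * p)) Se₁≡ ⟩
  S^ (m * j * p) (S^ (m * j) e₁) ≡⟨ S^-inverseˡ (m * j) e₁ ⟩
  e₁                           ∎))

X⊆Cyclic⇒gcd≡1 : ∀ j ℓ → (∀ (F : F2^ (suc p) → F2^ (suc p)) → InX j ℓ F → Cyclic F) → gcd j (suc p) ≡ 1
X⊆Cyclic⇒gcd≡1 {p} j ℓ X⊆Cyclic = S[e₁]∈orbit⇒gcd≡1
  (indicator-Cyclic⇒S-closed P? (X⊆Cyclic _ (indicator-InX P? j ℓ λ _ → mk⇔ InOrbit-S^ InOrbit-S^⁻¹)) e₁ (0 , refl))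
  where
  P? : Decidable (InOrbit j (e₁ {p}))
  P? = inOrbit? j e₁

gcd≡1⇒X⊆Cyclic : ∀ j ℓ → gcd j (suc p) ≡ 1 → ∀ (F : F2^ (suc p) → F2^ (suc p)) → InX j ℓ F → Cyclic F
gcd≡1⇒X⊆Cyclic j ℓ coprime F h with gcd≡1⇒invertible j coprime
... | i , ij≡1 = InX-1⇒Cyclic (i * ℓ) (InX⇒InX-1 i j ℓ (i * ℓ) ij≡1 refl h)

gcd≡1⇒X≡X[1,k] : ∀ j ℓ → gcd j (suc p) ≡ 1 →
                 ∃ λ k → 1 ≤ k × k ≤ suc p × (∀ (F : F2^ (suc p) → F2^ (suc p)) → InX j ℓ F ⇔ InX 1 k F)
gcd≡1⇒X≡X[1,k] j ℓ coprime with gcd≡1⇒invertible j coprime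
... | i , ij≡1 with %-representative (i * ℓ)
... | k , 1≤k , k≤n , k≡iℓ = k , 1≤k , k≤n , λ F →
  mk⇔ (InX⇒InX-1 i j ℓ k ij≡1 k≡iℓ) (InX-1⇒InX i j ℓ k ij≡1 k≡iℓ)

mainTheorem8 : ∀ (n : ℕ) → 1 ≤ n →
      (∀ (k : ℕ) → 1 ≤ k → k ≤ n → ∀ (F : F2^ n → F2^ n) →
         (∀ (x : F2^ n) → F (S x) ≡ S^ k (F x)) → Cyclic F)
    × (∀ (j ℓ : ℕ) → 1 ≤ j → j ≤ n → 1 ≤ ℓ → ℓ ≤ n →
         ((∀ (F : F2^ n → F2^ n) → InX j ℓ F → Cyclic F) ⇔ (gcd j n ≡ 1)))
    × (∀ (j ℓ : ℕ) → 1 ≤ j → j ≤ n → 1 ≤ ℓ → ℓ ≤ n → gcd j n ≡ 1 →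
         ∃ λ (k : ℕ) → 1 ≤ k × k ≤ n ×
           (∀ (F : F2^ n → F2^ n) → InX j ℓ F ⇔ InX 1 k F))
mainTheorem8 zero    ()
mainTheorem8 (suc p) _ =
    (λ k _ _ F → InX-1⇒Cyclic k)
  , (λ j ℓ _ _ _ _ → mk⇔ (X⊆Cyclic⇒gcd≡1 j ℓ) (gcd≡1⇒X⊆Cyclic j ℓ))
  , λ j ℓ _ _ _ _ → gcd≡1⇒X≡X[1,k] j ℓ
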